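{- For every positive integer $n$, the map $\theta$ restricts to a linear isomorphism from the space $\mathcal{ESG}(n)$ of even Steinhaus graphs of order $n$ onto the space $\mathcal{DST}_0(2n-1)$.
   Context: A binary Steinhaus triangle of size $N\ge0$ is an array $(a_{i,j})_{1\le i\le j\le N}$ of elements of $\{0,1\}$ with $a_{i,j}\equiv a_{i-1,j-1}+a_{i-1,j}\pmod 2$ for all $2\le i\le j\le N$. It is determined by its first row, and $\nabla S$ denotes the triangle whose first row is $S$. These triangles form a vector space over $\mathbb{Z}/2\mathbb{Z}$ under entrywise addition mod 2. The rotation is $r((a_{i,j}))=(a_{j-i+1,N-i+1})_{1\le i\le j\le N}$ and the reflection is $h((a_{i,j}))=(a_{i,N-j+i})_{1\le i\le j\le N}$. The space $\mathcal{DST}_0(N)$ consists of the triangles $\nabla S$ of size $N$ with $r(\nabla S)=h(\nabla S)=\nabla S$ and with the number of ones in $S$ even. For a binary sequence $S=(s_1,\dots,s_{n-1})$, the Steinhaus graph $G(S)$ is the simple graph on $v_1,\dots,v_n$ whose adjacency matrix $(a_{i,j})$ is symmetric with zero diagonal, has $a_{1,j}=s_{j-1}$ for $2\le j\le n$, and satisfies $a_{i,j}\equiv a_{i-1,j-1}+a_{i-1,j}\pmod 2$ for $2\le i<j\le n$. Steinhaus graphs of order $n$ form a vector space via $G(S)+G(T)=G(S+T)$. $\mathcal{ESG}(n)$ is the subspace of Steinhaus graphs of order $n$ in which all degrees are even. For a binary sequence $T=(t_1,\dots,t_m)$: $ir(T)=(b_j)_{1\le j\le 2m}$ with $b_{2j-1}=t_j$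 and $b_{2j}=t_{m-j+1}$. The antiderived sequence $\int_{i,x}T=(c_j)_{1\le j\le m+1}$ has $c_j\equiv x+\sum_{k=1}^{i-1}t_k+\sum_{k=1}^{j-1}t_k\pmod 2$. Finally, $\theta(G(S))=\nabla(\int_{n,0}ir(S))$, a Steinhaus triangle of size $2n-1$. -}

module Defs where

open import Data.Nat using (ℕ; zero; suc; _+_; _*_; _∸_; _≤_; _%_; _<ᵇ_; ⌊_/2⌋)
open import Data.Bool using (Bool; true; false; _xor_; if_then_else_)
open import Data.Fin using (toℕ)
open import Data.Vec using (Vec; []; _∷_; tabulate; zipWith)
open import Data.Product using (_×_)
open import Relation.Binary.PropositionalEquality using (_≡_)

-- Conventions: all indices are 1-based natural numbers, as in the paper.
-- A binary sequence of length m is a  Vec Bool m  (true = 1, false = 0).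

-- 1-based access to a vector (false outside the range 1..m; never used there).
at : ∀ {m} → Vec Bool m → ℕ → Bool
at [] _ = false
at (x ∷ xs) zero = false
at (x ∷ xs) (suc zero) = x
at (x ∷ xs) (suc (suc k)) = at xs (suc k)

fromFun : (m : ℕ) → (ℕ → Bool) → Vec Bool m
fromFun m f = tabulate (λ k → f (suc (toℕ k)))

_⊕_ : ∀ {m} → Vec Bool m → Vec Bool m → Vec Bool m
_⊕_ = zipWith _xor_

countF : (ℕ → Bool) → ℕ → ℕ
countF f zero = 0
countF f (suc m) = countF f m + (if f (suc m) then 1 else 0)

psum : (ℕ → Bool) → ℕ → Bool
psum t zero = false
psum t (suc k) = psum t k xor t (suc k)

-- The Steinhaus triangle ∇S is determined by its first row S, so a
-- triangle of size N is represented by its first row (Vec Bool N);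
-- entrywise addition of triangles is then _⊕_ on first rows.
-- stein s i j is the entry a_{i,j} of the array with a_{1,j} = s j and
-- a_{i,j} = a_{i-1,j-1} + a_{i-1,j}  (mod 2).

stein : (ℕ → Bool) → ℕ → ℕ → Bool
stein s zero j = false
stein s (suc zero) j = s j
stein s (suc (suc i)) zero = false
stein s (suc (suc i)) (suc j) = stein s (suc i) j xor stein s (suc i) (suc j)

tri : ∀ {N} → Vec Bool N → ℕ → ℕ → Bool
tri S = stein (at S)

RotInv : (N : ℕ) → Vec Bool N → Set
RotInv N S = ∀ i j → 1 ≤ i → i ≤ j → j ≤ N →
  tri S (j ∸ i + 1) (N ∸ i + 1) ≡ tri S i j

RefInv : (N : ℕ) → Vec Bool N → Set
RefInv N S = ∀ i j → 1 ≤ i → i ≤ j → j ≤ N →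
  tri S i (N ∸ j + i) ≡ tri S i j

DST₀ : (N : ℕ) → Vec Bool N → Set
DST₀ N S = RotInv N S × RefInv N S × (countF (at S) N % 2 ≡ 0)

-- Steinhaus graphs.  A Steinhaus graph of order n is G(S) for a
-- sequence S of length n - 1; it is represented by S (G(S) = G(S') iff
-- S = S', and G(S) + G(S') = G(S ⊕ S')).

-- upper triangular part: a_{1,j} = s_{j-1}, a_{i,j} = a_{i-1,j-1} + a_{i-1,j}
adjUp : ∀ {m} → Vec Bool m → ℕ → ℕ → Bool
adjUp S = stein (λ j → at S (j ∸ 1))

adj : ∀ {m} → Vec Bool m → ℕ → ℕ → Bool
adj S i j = if i <ᵇ j then adjUp S i j else (if j <ᵇ i then adjUp S j i else false)

degree : (n : ℕ) → Vec Bool (n ∸ 1) → ℕ → ℕ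
degree n S i = countF (adj S i) n

EvenSG : (n : ℕ) → Vec Bool (n ∸ 1) → Set
EvenSG n S = ∀ i → 1 ≤ i → i ≤ n → degree n S i % 2 ≡ 0

isOdd : ℕ → Bool
isOdd zero = false
isOdd (suc k) = if isOdd k then false else true

-- ir(T) as a function of the 1-based index p, T of length m:
-- b_{2j-1} = t_j ,  b_{2j} = t_{m-j+1}
irF : ℕ → (ℕ → Bool) → ℕ → Bool
irF m t p = if isOdd p then t (suc ⌊ p /2⌋) else t (suc (m ∸ ⌊ p /2⌋))

ir : ∀ {m} → Vec Bool m → Vec Bool (2 * m)
ir {m} T = fromFun (2 * m) (irF m (at T))

-- ∫_{i,x} T : c_j = x + Σ_{k<i} t_k + Σ_{k<j} t_k  (mod 2), length m+1
antider : ∀ {m} → ℕ → Bool → Vec Bool m → Vec Bool (suc m)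
antider {m} i x T = fromFun (suc m) (λ j → (x xor psum (at T) (i ∸ 1)) xor psum (at T) (j ∸ 1))

-- θ(G(S)) = ∇(∫_{n,0} ir(S)), a triangle of size 2n - 1 (represented by
-- its first row).
θ : (n : ℕ) → Vec Bool (n ∸ 1) → Vec Bool (2 * n ∸ 1)
θ n S = fromFun (2 * n ∸ 1) (at (antider n false (ir S)))

module Submission where

-- Everything is read off first rows.  A triangle ∇T is reflection
-- invariant iff T is a palindrome, and then rotation invariant iff its left
-- edge equals T (firstRow⇒dst₀, dst₀⇒firstRow).  The first row c of
-- θ(G(S)) = ∇(∫ ir S) is always a palindrome with middle entry 0, because
-- ir S is a palindrome; so θ(G(S)) ∈ DST₀ iff the left edge of ∇(ir S)
-- matches ∫ ir S (EdgeCondition).  On the graph side the degree parities of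
-- G(S) are consecutive differences of X = edge s + psum s + edge s̃, where
-- edge is the left edge of a Steinhaus triangle and s̃ is S reversed; the
-- edge condition splits, by decimating ir S into S and s̃, into equations
-- between X and Y = edge s̃ + psum s̃.  The identity Y-step (edge is an
-- involution) ties Y to X, and the combinatorial lemma Core shows that both
-- conditions say that X vanishes.  Linearity is entrywise; θ⁻¹, reading S
-- off the second row of ∇T, is a two-sided inverse on the relevant sets.

open import Defs
open import Data.Nat using (ℕ; zero; suc; pred; _+_; _*_; _∸_; _≤_; _<_; z≤n; s≤s; _%_; ⌊_/2⌋; _<ᵇ_)
open import Data.Nat.Properties
open import Data.Nat.DivMod using (%-distribˡ-+)
open import Data.Nat.Tactic.RingSolver using (solve-∀)
open import Data.Bool using (Bool; true; false; _xor_; if_then_else_)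
open import Data.Bool.Properties using (xor-∧-commutativeRing; xor-same; xor-comm; xor-assoc; xor-identityʳ)
import Data.Bool.Properties as Bool
open import Algebra.Solver.Ring.AlmostCommutativeRing using (fromCommutativeRing)
import Algebra.Solver.Ring.Simple as RingSolver
open import Data.Product using (_×_; _,_; proj₁; proj₂; Σ-syntax)
open import Data.Sum using (_⊎_; inj₁; inj₂)
open import Data.Empty using (⊥; ⊥-elim)
open import Function using (_∘_)
open import Data.Vec using (Vec; []; _∷_)
open import Data.Vec.Properties using (tabulate-cong)
open import Data.Fin using (toℕ)
open import Relation.Binary.PropositionalEquality
open ≡-Reasoning

-- Identities of the Boolean ring (Bool, xor, ∧) are decided by the ring
-- solver: since the coefficients are Booleans, 1 + 1 normalises to 0.
open RingSolver (fromCommutativeRing xor-∧-commutativeRing) Bool._≟_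
  using (solve; con; _:+_; _:=_)

xor≡false⇒≡ : ∀ {a b} → a xor b ≡ false → a ≡ b
xor≡false⇒≡ {false} {false} _ = refl
xor≡false⇒≡ {true}  {true}  _ = refl

≡⇒xor≡false : ∀ {a b} → a ≡ b → a xor b ≡ false
≡⇒xor≡false {a} refl = xor-same a

xor-transfer : ∀ {a b a′ b′} → a xor b ≡ a′ xor b′ → a ≡ b → a′ ≡ b′
xor-transfer e a≡b = xor≡false⇒≡ (trans (sym e) (≡⇒xor≡false a≡b))

-- Sequences are 1-based functions ℕ → Bool (the value at 0 is irrelevant).
Seq : Set
Seq = ℕ → Bool

psum-local : ∀ (f g : Seq) k → (∀ j → 1 ≤ j → j ≤ k → f j ≡ g j) → psum f k ≡ psum g k
psum-local f g zero    _  = refl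
psum-local f g (suc k) eq =
  cong₂ _xor_ (psum-local f g k (λ j 1≤j j≤k → eq j 1≤j (m≤n⇒m≤1+n j≤k))) (eq (suc k) (s≤s z≤n) ≤-refl)

psum-xor : ∀ (f g : Seq) k → psum (λ j → f j xor g j) k ≡ psum f k xor psum g k
psum-xor f g zero    = refl
psum-xor f g (suc k) rewrite psum-xor f g k =
  solve 4 (λ a b c d → (a :+ b) :+ (c :+ d) := (a :+ c) :+ (b :+ d)) refl (psum f k) (psum g k) (f (suc k)) (g (suc k))

psum-split : ∀ (f : Seq) a b → psum f (a + b) ≡ psum f a xor psum (λ j → f (a + j)) b
psum-split f a zero    rewrite +-identityʳ a = sym (xor-identityʳ (psum f a))
psum-split f a (suc b) rewrite +-suc a b | psum-split f a b = xor-assoc (psum f a) _ (f (suc (a + b)))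

psum-reverse : ∀ (f : Seq) k → psum (λ j → f (suc k ∸ j)) k ≡ psum f k
psum-reverse f zero    = refl
psum-reverse f (suc k) = begin
  psum (λ j → f (suc (suc k) ∸ j)) (suc k)     ≡⟨ psum-split _ 1 k ⟩
  f (suc k) xor psum (λ j → f (suc k ∸ j)) k   ≡⟨ cong (f (suc k) xor_) (psum-reverse f k) ⟩
  f (suc k) xor psum f k                       ≡⟨ xor-comm (f (suc k)) (psum f k) ⟩
  psum f (suc k)                               ∎

telescope : ∀ (F : Seq) k → psum (λ j → F (suc j) xor F j) k ≡ F (suc k) xor F 1
telescope F zero    = sym (xor-same (F 1))
telescope F (suc k) rewrite telescope F k =
  solve 3 (λ a b c → (a :+ b) :+ (c :+ a) := c :+ b) refl (F (suc k)) (F 1) (F (suc (suc k)))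

countF-parity : ∀ (f : Seq) k → countF f k % 2 ≡ (if psum f k then 1 else 0)
countF-parity f zero    = refl
countF-parity f (suc k) = begin
  (countF f k + bit (f (suc k))) % 2             ≡⟨ %-distribˡ-+ (countF f k) (bit (f (suc k))) 2 ⟩
  (countF f k % 2 + bit (f (suc k)) % 2) % 2     ≡⟨ cong (λ z → (z + bit (f (suc k)) % 2) % 2) (countF-parity f k) ⟩
  (bit (psum f k) + bit (f (suc k)) % 2) % 2     ≡⟨ bit-xor (psum f k) (f (suc k)) ⟩
  bit (psum f (suc k))                           ∎
  where
  bit : Bool → ℕ
  bit b = if b then 1 else 0
  bit-xor : ∀ p q → (bit p + bit q % 2) % 2 ≡ bit (p xor q)
  bit-xor false false = refl
  bit-xor false true  = refl
  bit-xor true  false = refl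
  bit-xor true  true  = refl

countF-even⇒psum : ∀ (f : Seq) k → countF f k % 2 ≡ 0 → psum f k ≡ false
countF-even⇒psum f k even with psum f k | countF-parity f k
... | false | _   = refl
... | true  | odd with () ← trans (sym odd) even

psum⇒countF-even : ∀ (f : Seq) k → psum f k ≡ false → countF f k % 2 ≡ 0
psum⇒countF-even f k p rewrite countF-parity f k | p = refl

at-fromFun : ∀ L (f : Seq) k → k < L → at (fromFun L f) (suc k) ≡ f (suc k)
at-fromFun (suc L) f zero    _         = refl
at-fromFun (suc L) f (suc k) (s≤s k<L) = at-fromFun L (λ j → f (suc j)) k k<L

at-beyond : ∀ {L} (V : Vec Bool L) k → L ≤ k → at V (suc k) ≡ false
at-beyond []      k       _         = refl
at-beyond (x ∷ V) (suc k) (s≤s L≤k) = at-beyond V k L≤k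

vec-ext : ∀ {L} (V W : Vec Bool L) → (∀ k → k < L → at V (suc k) ≡ at W (suc k)) → V ≡ W
vec-ext []      []      _  = refl
vec-ext (x ∷ V) (y ∷ W) eq = cong₂ _∷_ (eq 0 (s≤s z≤n)) (vec-ext V W (λ k k<L → eq (suc k) (s≤s k<L)))

at-⊕ : ∀ {L} (V W : Vec Bool L) k → at (V ⊕ W) k ≡ at V k xor at W k
at-⊕ []      []      k             = refl
at-⊕ (x ∷ V) (y ∷ W) zero          = refl
at-⊕ (x ∷ V) (y ∷ W) (suc zero)    = refl
at-⊕ (x ∷ V) (y ∷ W) (suc (suc k)) = at-⊕ V W (suc k)

fromFun-xor : ∀ L (f g : Seq) → fromFun L (λ k → f k xor g k) ≡ fromFun L f ⊕ fromFun L g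
fromFun-xor zero    f g = refl
fromFun-xor (suc L) f g = cong ((f 1 xor g 1) ∷_) (fromFun-xor L (λ j → f (suc j)) (λ j → g (suc j)))

fromFun-cong : ∀ L (f g : Seq) → (∀ k → f k ≡ g k) → fromFun L f ≡ fromFun L g
fromFun-cong L f g eq = tabulate-cong (λ i → eq (suc (toℕ i)))

-- Iterated differences

-- delta f i x = (Δⁱ f)(x + 1), where (Δ f) k = f k + f (k + 1) mod 2.
-- By stein-delta it is the entry a_{i+1, x+i+1} of the Steinhaus array
-- with first row f; all triangle computations go through it.
delta : Seq → ℕ → ℕ → Bool
delta f zero    x = f (suc x)
delta f (suc i) x = delta f i x xor delta f i (suc x)

stein-delta : ∀ f i x → stein f (suc i) (suc (x + i)) ≡ delta f i x
stein-delta f zero    x rewrite +-identityʳ x = refl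
stein-delta f (suc i) x rewrite +-suc x i = cong₂ _xor_ (stein-delta f i x) (stein-delta f i (suc x))

delta-local : ∀ f g i x → (∀ t → t ≤ i → f (suc (x + t)) ≡ g (suc (x + t))) → delta f i x ≡ delta g i x
delta-local f g zero    x eq = subst (λ z → f (suc z) ≡ g (suc z)) (+-identityʳ x) (eq 0 z≤n)
delta-local f g (suc i) x eq = cong₂ _xor_
  (delta-local f g i x (λ t t≤i → eq t (m≤n⇒m≤1+n t≤i)))
  (delta-local f g i (suc x) (λ t t≤i → subst (λ z → f (suc z) ≡ g (suc z)) (+-suc x t) (eq (suc t) (s≤s t≤i))))

delta-local≤ : ∀ f g M i x → (∀ k → 1 ≤ k → k ≤ M → f k ≡ g k) → suc (x + i) ≤ M → delta f i x ≡ delta g i x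
delta-local≤ f g M i x eq x+i<M =
  delta-local f g i x (λ t t≤i → eq (suc (x + t)) (s≤s z≤n) (≤-trans (s≤s (+-monoʳ-≤ x t≤i)) x+i<M))

delta-cong : ∀ f g i x → (∀ k → f k ≡ g k) → delta f i x ≡ delta g i x
delta-cong f g i x eq = delta-local f g i x (λ t _ → eq (suc (x + t)))

delta-xor : ∀ f g i x → delta (λ k → f k xor g k) i x ≡ delta f i x xor delta g i x
delta-xor f g zero    x = refl
delta-xor f g (suc i) x rewrite delta-xor f g i x | delta-xor f g i (suc x) =
  solve 4 (λ a b c d → (a :+ b) :+ (c :+ d) := (a :+ c) :+ (b :+ d)) refl
    (delta f i x) (delta g i x) (delta f i (suc x)) (delta g i (suc x))

delta-false : ∀ i x → delta (λ _ → false) i x ≡ false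
delta-false zero    x = refl
delta-false (suc i) x rewrite delta-false i x | delta-false i (suc x) = refl

delta-suc : ∀ f i x → delta f (suc i) x ≡ delta (λ k → f k xor f (suc k)) i x
delta-suc f zero    x = refl
delta-suc f (suc i) x = cong₂ _xor_ (delta-suc f i x) (delta-suc f i (suc x))

delta-shift : ∀ f i x → delta f i (suc x) ≡ delta (λ k → f (suc k)) i x
delta-shift f zero    x = refl
delta-shift f (suc i) x = cong₂ _xor_ (delta-shift f i x) (delta-shift f i (suc x))

-- Frobenius in characteristic 2: Δ² f k = f k + f (k + 2).
delta-2+ : ∀ f i x → delta f (suc (suc i)) x ≡ delta f i x xor delta f i (suc (suc x))
delta-2+ f zero    x =
  solve 3 (λ a b c → (a :+ b) :+ (b :+ c) := a :+ c) refl (f (suc x)) (f (suc (suc x))) (f (suc (suc (suc x))))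
delta-2+ f (suc i) x rewrite delta-2+ f i x | delta-2+ f i (suc x) =
  solve 4 (λ a b c d → (a :+ b) :+ (c :+ d) := (a :+ c) :+ (b :+ d)) refl
    (delta f i x) (delta f i (suc (suc x))) (delta f i (suc x)) (delta f i (suc (suc (suc x))))

twice : ℕ → ℕ
twice zero    = zero
twice (suc k) = suc (suc (twice k))

-- Decimation: the differences of even order 2i of f, read at positions of
-- a fixed parity, are the differences of order i of the subsequence g of f
-- at those positions.
delta-decimate : ∀ f g y → (∀ k → f (suc (y + twice k)) ≡ g (suc k)) →
  ∀ i x → delta f (twice i) (y + twice x) ≡ delta g i x
delta-decimate f g y sub zero    x = sub x
delta-decimate f g y sub (suc i) x = begin
  delta f (twice (suc i)) (y + twice x)
    ≡⟨ delta-2+ f (twice i) (y + twice x) ⟩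
  delta f (twice i) (y + twice x) xor delta f (twice i) (suc (suc (y + twice x)))
    ≡⟨ cong (λ z → delta f (twice i) (y + twice x) xor delta f (twice i) z) (sym y+2x+2) ⟩
  delta f (twice i) (y + twice x) xor delta f (twice i) (y + twice (suc x))
    ≡⟨ cong₂ _xor_ (delta-decimate f g y sub i x) (delta-decimate f g y sub i (suc x)) ⟩
  delta g (suc i) x ∎
  where
  y+2x+2 : y + twice (suc x) ≡ suc (suc (y + twice x))
  y+2x+2 = trans (+-suc y (suc (twice x))) (cong suc (+-suc y (twice x)))

delta-mirror : ∀ f g i x y → (∀ t → t ≤ i → f (suc (x + t)) ≡ g (suc (y + (i ∸ t)))) →
  delta f i x ≡ delta g i y
delta-mirror f g zero    x y eq =
  subst₂ (λ u v → f (suc u) ≡ g (suc v)) (+-identityʳ x) (+-identityʳ y) (eq 0 z≤n)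
delta-mirror f g (suc i) x y eq = begin
  delta f i x xor delta f i (suc x)   ≡⟨ cong₂ _xor_ left right ⟩
  delta g i (suc y) xor delta g i y   ≡⟨ xor-comm (delta g i (suc y)) (delta g i y) ⟩
  delta g (suc i) y                   ∎
  where
  left : delta f i x ≡ delta g i (suc y)
  left = delta-mirror f g i x (suc y) (λ t t≤i → trans (eq t (m≤n⇒m≤1+n t≤i))
           (cong (λ z → g (suc z)) (trans (cong (y +_) (+-∸-assoc 1 t≤i)) (+-suc y (i ∸ t)))))
  right : delta f i (suc x) ≡ delta g i y
  right = delta-mirror f g i (suc x) y (λ t t≤i →
            trans (cong (λ z → f (suc z)) (sym (+-suc x t))) (eq (suc t) (s≤s t≤i)))

-- The left edge of the Steinhaus array with first row f (padded by
-- edge f 0 = false).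
edge : Seq → Seq
edge f zero    = false
edge f (suc k) = delta f k 0

-- The array with first row edge f is the transpose of the one with first
-- row f; in particular edge is an involution on positive indices.
delta-edge : ∀ f i x → delta (edge f) i x ≡ delta f x i
delta-edge f zero    x = refl
delta-edge f (suc i) x rewrite delta-edge f i x | delta-edge f i (suc x) =
  solve 2 (λ a b → a :+ (a :+ b) := b) refl (delta f x i) (delta f x (suc i))

edge-involutive : ∀ f k → edge (edge f) (suc k) ≡ f (suc k)
edge-involutive f k = delta-edge f k 0

-- Symmetries of a Steinhaus triangle, read off its first row

Palindrome : ℕ → Seq → Set
Palindrome N f = ∀ x y → suc (x + y) ≡ N → f (suc x) ≡ f (suc y)

EdgeIsTop : ℕ → Seq → Set
EdgeIsTop N f = ∀ k → k < N → delta f k 0 ≡ f (suc k)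

-- The two symmetries in difference coordinates: a_{a+1, b+a+1} = delta f a b,
-- and positions of a triangle of size N correspond to a + b + c + 1 = N.
DeltaRef : ℕ → Seq → Set
DeltaRef N f = ∀ a b c → suc (a + b + c) ≡ N → delta f a b ≡ delta f a c

DeltaRot : ℕ → Seq → Set
DeltaRot N f = ∀ a b c → suc (a + b + c) ≡ N → delta f b c ≡ delta f a b

palindrome⇒deltaRef : ∀ N f → Palindrome N f → DeltaRef N f
palindrome⇒deltaRef N f pal a b c refl = delta-mirror f f a b c (λ t t≤a →
  pal (b + t) (c + (a ∸ t)) (cong suc (trans (arith b t c (a ∸ t)) (cong (λ z → z + b + c) (m∸n+n≡m t≤a)))))
  where
  arith : ∀ b t c w → (b + t) + (c + w) ≡ (w + t) + b + c
  arith = solve-∀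

delta-transpose : ∀ N f → EdgeIsTop N f → ∀ a b → suc (a + b) ≤ N → delta f a b ≡ delta f b a
delta-transpose N f top a b a+b<N = begin
  delta f a b          ≡⟨ sym (delta-local≤ (edge f) f N a b edge≡f b+a<N) ⟩
  delta (edge f) a b   ≡⟨ delta-edge f a b ⟩
  delta f b a          ∎
  where
  edge≡f : ∀ k → 1 ≤ k → k ≤ N → edge f k ≡ f k
  edge≡f (suc k) _ k<N = top k k<N
  b+a<N : suc (b + a) ≤ N
  b+a<N = subst (λ z → suc z ≤ N) (+-comm a b) a+b<N

edge+ref⇒rot : ∀ N f → EdgeIsTop N f → DeltaRef N f → DeltaRot N f
edge+ref⇒rot N f top ref a b c refl = begin
  delta f b c   ≡⟨ sym (ref b a c (cong (λ z → suc (z + c)) (+-comm b a))) ⟩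
  delta f b a   ≡⟨ delta-transpose N f top b a (s≤s (subst (_≤ a + b + c) (+-comm a b) (m≤m+n (a + b) c))) ⟩
  delta f a b   ∎

rot+ref⇒edge : ∀ N f → DeltaRot N f → DeltaRef N f → EdgeIsTop N f
rot+ref⇒edge N f rot ref k k<N with m≤n⇒∃[o]m+o≡n k<N
... | c , refl = begin
  delta f k 0       ≡⟨ sym (rot k 0 c (cong (λ z → suc (z + c)) (+-identityʳ k))) ⟩
  delta f 0 c       ≡⟨ ref 0 c k (cong suc (arith k c)) ⟩
  delta f 0 k       ∎
  where
  arith : ∀ k c → c + k ≡ k + c
  arith = solve-∀

coordinates : ∀ N i j → 1 ≤ i → i ≤ j → j ≤ N →
  Σ[ a ∈ ℕ ] Σ[ b ∈ ℕ ] Σ[ c ∈ ℕ ] (i ≡ suc a × j ≡ suc (b + a) × N ≡ suc (a + b + c))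
coordinates N (suc a) j (s≤s z≤n) i≤j j≤N with m≤n⇒∃[o]m+o≡n i≤j
... | b , refl with m≤n⇒∃[o]m+o≡n j≤N
... | c , refl = a , b , c , refl , cong suc (+-comm a b) , refl

rotated-row : ∀ a b → suc (b + a) ∸ suc a + 1 ≡ suc b
rotated-row a b = trans (cong (_+ 1) (m+n∸n≡m b a)) (+-comm b 1)

rotated-column : ∀ a b c → suc (a + b + c) ∸ suc a + 1 ≡ suc (c + b)
rotated-column a b c = begin
  a + b + c ∸ a + 1     ≡⟨ cong (λ z → z ∸ a + 1) (+-assoc a b c) ⟩
  a + (b + c) ∸ a + 1   ≡⟨ cong (_+ 1) (m+n∸m≡n a (b + c)) ⟩
  b + c + 1             ≡⟨ arith b c ⟩
  suc (c + b)           ∎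
  where
  arith : ∀ b c → b + c + 1 ≡ suc (c + b)
  arith = solve-∀

reflected-column : ∀ a b c → suc (a + b + c) ∸ suc (b + a) + suc a ≡ suc (c + a)
reflected-column a b c = begin
  a + b + c ∸ (b + a) + suc a   ≡⟨ cong (λ z → z + c ∸ (b + a) + suc a) (+-comm a b) ⟩
  b + a + c ∸ (b + a) + suc a   ≡⟨ cong (_+ suc a) (m+n∸m≡n (b + a) c) ⟩
  c + suc a                     ≡⟨ +-suc c a ⟩
  suc (c + a)                   ∎

module _ (N : ℕ) (T : Vec Bool N) where

  private
    below : ∀ a b c → suc (b + a) ≤ suc (a + b + c)
    below a b c = s≤s (subst (_≤ a + b + c) (+-comm a b) (m≤m+n (a + b) c))

  rotInv⇒deltaRot : RotInv N T → DeltaRot N (at T)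
  rotInv⇒deltaRot rotInv a b c refl = begin
    delta (at T) b c               ≡⟨ sym (stein-delta (at T) b c) ⟩
    tri T (suc b) (suc (c + b))    ≡⟨ sym (cong₂ (tri T) (rotated-row a b) (rotated-column a b c)) ⟩
    tri T (suc (b + a) ∸ suc a + 1) (suc (a + b + c) ∸ suc a + 1)
                                   ≡⟨ rotInv (suc a) (suc (b + a)) (s≤s z≤n) (s≤s (m≤n+m a b)) (below a b c) ⟩
    tri T (suc a) (suc (b + a))    ≡⟨ stein-delta (at T) a b ⟩
    delta (at T) a b               ∎

  deltaRot⇒rotInv : DeltaRot N (at T) → RotInv N T
  deltaRot⇒rotInv rot i j 1≤i i≤j j≤N with coordinates N i j 1≤i i≤j j≤N
  ... | a , b , c , refl , refl , refl = begin
    tri T (suc (b + a) ∸ suc a + 1) (suc (a + b + c) ∸ suc a + 1)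
                                   ≡⟨ cong₂ (tri T) (rotated-row a b) (rotated-column a b c) ⟩
    tri T (suc b) (suc (c + b))    ≡⟨ stein-delta (at T) b c ⟩
    delta (at T) b c               ≡⟨ rot a b c refl ⟩
    delta (at T) a b               ≡⟨ sym (stein-delta (at T) a b) ⟩
    tri T (suc a) (suc (b + a))    ∎

  refInv⇒deltaRef : RefInv N T → DeltaRef N (at T)
  refInv⇒deltaRef refInv a b c refl = begin
    delta (at T) a b               ≡⟨ sym (stein-delta (at T) a b) ⟩
    tri T (suc a) (suc (b + a))    ≡⟨ sym (refInv (suc a) (suc (b + a)) (s≤s z≤n) (s≤s (m≤n+m a b)) (below a b c)) ⟩
    tri T (suc a) (suc (a + b + c) ∸ suc (b + a) + suc a)
                                   ≡⟨ cong (tri T (suc a)) (reflected-column a b c) ⟩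
    tri T (suc a) (suc (c + a))    ≡⟨ stein-delta (at T) a c ⟩
    delta (at T) a c               ∎

  deltaRef⇒refInv : DeltaRef N (at T) → RefInv N T
  deltaRef⇒refInv ref i j 1≤i i≤j j≤N with coordinates N i j 1≤i i≤j j≤N
  ... | a , b , c , refl , refl , refl = begin
    tri T (suc a) (suc (a + b + c) ∸ suc (b + a) + suc a)
                                   ≡⟨ cong (tri T (suc a)) (reflected-column a b c) ⟩
    tri T (suc a) (suc (c + a))    ≡⟨ stein-delta (at T) a c ⟩
    delta (at T) a c               ≡⟨ sym (ref a b c refl) ⟩
    delta (at T) a b               ≡⟨ sym (stein-delta (at T) a b) ⟩
    tri T (suc a) (suc (b + a))    ∎

  dst₀⇒firstRow : DST₀ N T → Palindrome N (at T) × EdgeIsTop N (at T) × psum (at T) N ≡ false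
  dst₀⇒firstRow (rotInv , refInv , even) =
    (λ x y opposite → ref 0 x y opposite) , rot+ref⇒edge N (at T) (rotInv⇒deltaRot rotInv) ref ,
    countF-even⇒psum (at T) N even
    where
    ref : DeltaRef N (at T)
    ref = refInv⇒deltaRef refInv

  firstRow⇒dst₀ : Palindrome N (at T) → EdgeIsTop N (at T) → psum (at T) N ≡ false → DST₀ N T
  firstRow⇒dst₀ pal top sum =
    deltaRot⇒rotInv (edge+ref⇒rot N (at T) top ref) , deltaRef⇒refInv ref , psum⇒countF-even (at T) N sum
    where
    ref : DeltaRef N (at T)
    ref = palindrome⇒deltaRef N (at T) pal

palindrome-psum : ∀ b x y → Palindrome (x + y) b → psum b (x + y) ≡ psum b x xor psum b y
palindrome-psum b x y pal = begin
  psum b (x + y)                                    ≡⟨ psum-split b x y ⟩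
  psum b x xor psum (λ j → b (x + j)) y             ≡⟨ cong (psum b x xor_) (psum-local _ _ y mirror) ⟩
  psum b x xor psum (λ j → b (suc y ∸ j)) y         ≡⟨ cong (psum b x xor_) (psum-reverse b y) ⟩
  psum b x xor psum b y                             ∎
  where
  mirror : ∀ j → 1 ≤ j → j ≤ y → b (x + j) ≡ b (suc y ∸ j)
  mirror (suc j) _ j<y = begin
    b (x + suc j)          ≡⟨ cong b (+-suc x j) ⟩
    b (suc (x + j))        ≡⟨ pal (x + j) (y ∸ suc j) lengths ⟩
    b (suc (y ∸ suc j))    ≡⟨ cong b (sym (+-∸-assoc 1 j<y)) ⟩
    b (y ∸ j)              ∎
    where
    arith : ∀ x j w → suc (x + j + w) ≡ x + (w + suc j)
    arith = solve-∀
    lengths : suc (x + j + (y ∸ suc j)) ≡ x + y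
    lengths = trans (arith x j (y ∸ suc j)) (cong (x +_) (m∸n+n≡m j<y))

twice≡+ : ∀ k → twice k ≡ k + k
twice≡+ zero    = refl
twice≡+ (suc k) = cong suc (trans (cong suc (twice≡+ k)) (sym (+-suc k k)))

n≤twice : ∀ n → n ≤ twice n
n≤twice n = subst (n ≤_) (sym (twice≡+ n)) (m≤m+n n n)

twice-+ : ∀ a b → twice a + twice b ≡ twice (a + b)
twice-+ zero    b = refl
twice-+ (suc a) b = cong (λ z → suc (suc z)) (twice-+ a b)

psum-even-palindrome : ∀ m b → Palindrome (twice m) b → ∀ x y → x + y ≡ twice m → psum b x ≡ psum b y
psum-even-palindrome m b pal x y x+y≡2m = xor≡false⇒≡ (begin
  psum b x xor psum b y   ≡⟨ sym (palindrome-psum b x y (subst (λ L → Palindrome L b) (sym x+y≡2m) pal)) ⟩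
  psum b (x + y)          ≡⟨ cong (psum b) (trans x+y≡2m (twice≡+ m)) ⟩
  psum b (m + m)          ≡⟨ palindrome-psum b m m (subst (λ L → Palindrome L b) (twice≡+ m) pal) ⟩
  psum b m xor psum b m   ≡⟨ xor-same (psum b m) ⟩
  false                   ∎)

psum-odd-palindrome : ∀ m g → Palindrome (suc (twice m)) g → psum g (suc (twice m)) ≡ g (suc m)
psum-odd-palindrome m g pal = begin
  psum g (suc (twice m))                  ≡⟨ cong (psum g) 2m+1≡ ⟩
  psum g (m + suc m)                      ≡⟨ palindrome-psum g m (suc m) (subst (λ L → Palindrome L g) 2m+1≡ pal) ⟩
  psum g m xor (psum g m xor g (suc m))   ≡⟨ solve 2 (λ a b → a :+ (a :+ b) := b) refl (psum g m) (g (suc m)) ⟩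
  g (suc m)                               ∎
  where
  2m+1≡ : suc (twice m) ≡ m + suc m
  2m+1≡ = trans (cong suc (twice≡+ m)) (sym (+-suc m m))

parity : ∀ x → Σ[ j ∈ ℕ ] (x ≡ twice j ⊎ x ≡ suc (twice j))
parity zero = 0 , inj₁ refl
parity (suc x) with parity x
... | j , inj₁ refl = j , inj₂ refl
... | j , inj₂ refl = suc j , inj₁ refl

odd≢even : ∀ a b → suc (twice a) ≡ twice b → ⊥
odd≢even zero    zero    ()
odd≢even zero    (suc b) ()
odd≢even (suc a) zero    ()
odd≢even (suc a) (suc b) eq = odd≢even a b (cong (pred ∘ pred) eq)

isOdd-twice : ∀ k → isOdd (twice k) ≡ false
isOdd-twice zero    = refl
isOdd-twice (suc k) rewrite isOdd-twice k = refl

half-twice : ∀ k → ⌊ twice k /2⌋ ≡ k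
half-twice zero    = refl
half-twice (suc k) = cong suc (half-twice k)

half-suc-twice : ∀ k → ⌊ suc (twice k) /2⌋ ≡ k
half-suc-twice zero    = refl
half-suc-twice (suc k) = cong suc (half-suc-twice k)

irF-odd : ∀ m t k → irF m t (suc (twice k)) ≡ t (suc k)
irF-odd m t k rewrite isOdd-twice k | half-suc-twice k = refl

irF-even : ∀ m t k → irF m t (twice (suc k)) ≡ t (suc (m ∸ suc k))
irF-even m t k rewrite isOdd-twice k | half-twice k = refl

twice-injective : ∀ a b → twice a ≡ twice b → a ≡ b
twice-injective zero    zero    _  = refl
twice-injective (suc a) (suc b) eq = cong suc (twice-injective a b (cong (pred ∘ pred) eq))

irF-mirror : ∀ m t j q → suc (j + q) ≡ m → irF m t (suc (twice j)) ≡ irF m t (twice (suc q))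
irF-mirror m t j q j+q+1≡m = begin
  irF m t (suc (twice j))        ≡⟨ irF-odd m t j ⟩
  t (suc j)                      ≡⟨ cong (t ∘ suc) (sym (m+n∸n≡m j (suc q))) ⟩
  t (suc (j + suc q ∸ suc q))    ≡⟨ cong (λ z → t (suc (z ∸ suc q))) (trans (+-suc j q) j+q+1≡m) ⟩
  t (suc (m ∸ suc q))            ≡⟨ sym (irF-even m t q) ⟩
  irF m t (twice (suc q))        ∎

twice-< : ∀ {t m} → t < m → suc (twice t) < twice m
twice-< {zero}  {suc m} _         = s≤s (s≤s z≤n)
twice-< {suc t} {suc m} (s≤s t<m) = s≤s (s≤s (twice-< t<m))

twice-<⁻¹ : ∀ {t m} → twice t < twice m → t < m
twice-<⁻¹ {zero}  {suc m} _                 = s≤s z≤n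
twice-<⁻¹ {suc t} {suc m} (s≤s (s≤s 2t<2m)) = s≤s (twice-<⁻¹ 2t<2m)

halve : ∀ j q m → suc (suc (twice j + twice q)) ≡ twice m → suc (j + q) ≡ m
halve j q m eq = twice-injective (suc (j + q)) m (trans (cong (suc ∘ suc) (sym (twice-+ j q))) eq)

-- Hence ir(t) is a palindrome (mirror positions have opposite parities).
ir-palindrome : ∀ m t → Palindrome (twice m) (irF m t)
ir-palindrome m t x y opposite with parity x | parity y
... | j , inj₁ refl | q , inj₁ refl =
  ⊥-elim (odd≢even (j + q) m (trans (cong suc (sym (twice-+ j q))) opposite))
... | j , inj₁ refl | q , inj₂ refl =
  irF-mirror m t j q (halve j q m (trans (cong suc (sym (+-suc (twice j) (twice q)))) opposite))
... | j , inj₂ refl | q , inj₁ refl =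
  sym (irF-mirror m t q j (halve q j m (trans (cong (suc ∘ suc) (+-comm (twice q) (twice j))) opposite)))
... | j , inj₂ refl | q , inj₂ refl =
  ⊥-elim (odd≢even (suc (j + q)) m
    (trans (cong (suc ∘ suc) (sym (trans (+-suc (twice j) (twice q)) (cong suc (twice-+ j q))))) opposite))

-- The first row of θ(G(S))

-- The left edge of ∇(ir t) agrees with the antiderivative ∫_{m+1,0} ir(t)
-- shifted by one place; this is what remains of rotation invariance for
-- a triangle θ(G(S)), see theta-edge⇔.
EdgeCondition : ℕ → Seq → Set
EdgeCondition m t = ∀ p → p < twice m → delta (irF m t) p 0 ≡ psum (irF m t) m xor psum (irF m t) (suc p)

2*≡twice : ∀ m → 2 * m ≡ twice m
2*≡twice m = trans (cong (m +_) (+-identityʳ m)) (sym (twice≡+ m))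

size : ∀ m → 2 * suc m ∸ 1 ≡ suc (twice m)
size m = cong pred (2*≡twice (suc m))

module ThetaRow (m : ℕ) (S : Vec Bool m) where

  b : Seq
  b = irF m (at S)

  c : Seq
  c = at (θ (suc m) S)

  -- The constant of integration of c.
  c₀ : Bool
  c₀ = psum b m

  psum-ir : ∀ k → k ≤ twice m → psum (at (ir S)) k ≡ psum b k
  psum-ir k k≤2m = psum-local _ _ k (λ { (suc p) _ p<k →
    at-fromFun (2 * m) b p (subst (p <_) (sym (2*≡twice m)) (≤-trans p<k k≤2m)) })

  c-value : ∀ k → k ≤ twice m → c (suc k) ≡ c₀ xor psum b k
  c-value k k≤2m = begin
    c (suc k)                                            ≡⟨ at-fromFun _ (at (antider (suc m) false (ir S))) k (subst (k <_) (sym (size m)) (s≤s k≤2m)) ⟩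
    at (antider (suc m) false (ir S)) (suc k)            ≡⟨ at-fromFun (suc (2 * m)) (λ j → psum (at (ir S)) m xor psum (at (ir S)) (j ∸ 1)) k (s≤s (subst (k ≤_) (sym (2*≡twice m)) k≤2m)) ⟩
    psum (at (ir S)) m xor psum (at (ir S)) k            ≡⟨ cong₂ _xor_ (psum-ir m (n≤twice m)) (psum-ir k k≤2m) ⟩
    c₀ xor psum b k                                      ∎

  -- c is a palindrome (since ir(S) is) with middle entry 0, hence of even weight.
  c-palindrome : Palindrome (suc (twice m)) c
  c-palindrome x y opposite = begin
    c (suc x)            ≡⟨ c-value x (subst (x ≤_) (cong pred opposite) (m≤m+n x y)) ⟩
    c₀ xor psum b x      ≡⟨ cong (c₀ xor_) (psum-even-palindrome m b (ir-palindrome m (at S)) x y (cong pred opposite)) ⟩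
    c₀ xor psum b y      ≡⟨ sym (c-value y (subst (y ≤_) (cong pred opposite) (m≤n+m y x))) ⟩
    c (suc y)            ∎

  c-sum : psum c (suc (twice m)) ≡ false
  c-sum = begin
    psum c (suc (twice m))   ≡⟨ psum-odd-palindrome m c c-palindrome ⟩
    c (suc m)                ≡⟨ c-value m (n≤twice m) ⟩
    c₀ xor c₀                ≡⟨ xor-same c₀ ⟩
    false                    ∎

  c-differences : ∀ p → p < twice m → c (suc p) xor c (suc (suc p)) ≡ b (suc p)
  c-differences p p<2m = begin
    c (suc p) xor c (suc (suc p))                        ≡⟨ cong₂ _xor_ (c-value p (<⇒≤ p<2m)) (c-value (suc p) p<2m) ⟩
    (c₀ xor psum b p) xor (c₀ xor (psum b p xor b (suc p)))
                                                         ≡⟨ solve 3 (λ x y z → (x :+ y) :+ (x :+ (y :+ z)) := z) refl c₀ (psum b p) (b (suc p)) ⟩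
    b (suc p)                                            ∎

  c-edge : ∀ p → p < twice m → delta c (suc p) 0 ≡ delta b p 0
  c-edge p p<2m = trans (delta-suc c p 0) (delta-local≤ _ b (twice m) p 0
    (λ { (suc t) _ t<2m → c-differences t t<2m }) p<2m)

  edge⇒condition : EdgeIsTop (suc (twice m)) c → EdgeCondition m (at S)
  edge⇒condition top p p<2m = begin
    delta b p 0           ≡⟨ sym (c-edge p p<2m) ⟩
    delta c (suc p) 0     ≡⟨ top (suc p) (s≤s p<2m) ⟩
    c (suc (suc p))       ≡⟨ c-value (suc p) p<2m ⟩
    c₀ xor psum b (suc p) ∎

  condition⇒edge : EdgeCondition m (at S) → EdgeIsTop (suc (twice m)) c
  condition⇒edge cond zero    _               = refl
  condition⇒edge cond (suc p) (s≤s p<2m) = begin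
    delta c (suc p) 0     ≡⟨ c-edge p p<2m ⟩
    delta b p 0           ≡⟨ cond p p<2m ⟩
    c₀ xor psum b (suc p) ≡⟨ sym (c-value (suc p) p<2m) ⟩
    c (suc (suc p))       ∎

-- Inverting edge (it is an involution) shows that the
-- increments of Y are controlled by X; in particular Y is constant where X
-- vanishes.
module EdgeIdentity (s u : Seq) where

  X : Seq
  X k = (edge s k xor psum s k) xor edge u k

  Y : Seq
  Y k = edge u k xor psum u k

  edge-psum : ∀ k → edge (psum s) (suc k) ≡ edge s (suc k) xor edge s k
  edge-psum zero    = sym (xor-identityʳ (s 1))
  edge-psum (suc k) = begin
    delta (psum s) (suc k) 0               ≡⟨ delta-suc (psum s) k 0 ⟩
    delta (λ j → psum s j xor psum s (suc j)) k 0
                                           ≡⟨ delta-cong _ (s ∘ suc) k 0 (λ j → solve 2 (λ a b → a :+ (a :+ b) := b) refl (psum s j) (s (suc j))) ⟩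
    delta (s ∘ suc) k 0                    ≡⟨ sym (delta-shift s k 0) ⟩
    delta s k 1                            ≡⟨ solve 2 (λ a b → b := (a :+ b) :+ a) refl (delta s k 0) (delta s k 1) ⟩
    delta s (suc k) 0 xor delta s k 0      ∎

  -- s is recovered as the left edge of edge s = X + psum s + edge u.
  s-from-X : ∀ k → s (suc k) ≡ edge X (suc k) xor ((edge s (suc k) xor edge s k) xor u (suc k))
  s-from-X k = begin
    s (suc k)                                                  ≡⟨ sym (edge-involutive s k) ⟩
    delta (edge s) k 0                                         ≡⟨ delta-cong _ _ k 0 edge-s ⟩
    delta (λ j → X j xor (psum s j xor edge u j)) k 0          ≡⟨ delta-xor X _ k 0 ⟩
    edge X (suc k) xor delta (λ j → psum s j xor edge u j) k 0 ≡⟨ cong (edge X (suc k) xor_) (delta-xor (psum s) (edge u) k 0) ⟩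
    edge X (suc k) xor (edge (psum s) (suc k) xor edge (edge u) (suc k))
                                                               ≡⟨ cong₂ (λ v w → edge X (suc k) xor (v xor w)) (edge-psum k) (edge-involutive u k) ⟩
    edge X (suc k) xor ((edge s (suc k) xor edge s k) xor u (suc k)) ∎
    where
    edge-s : ∀ j → edge s j ≡ X j xor (psum s j xor edge u j)
    edge-s j = solve 3 (λ d p r → d := ((d :+ p) :+ r) :+ (p :+ r)) refl (edge s j) (psum s j) (edge u j)

  -- Substituting s-from-X into X (k+1) leaves exactly the increment of Y.
  Y-step : ∀ k → Y (suc k) xor Y k ≡ (edge X (suc k) xor X (suc k)) xor X k
  Y-step k = begin
    (r₁ xor (psum u k xor u (suc k))) xor (r₀ xor psum u k)
      ≡⟨ solve 8 (λ e d₁ d₀ p r₁ r₀ q u₁ →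
                   (r₁ :+ (q :+ u₁)) :+ (r₀ :+ q)
                   := (e :+ ((d₁ :+ (p :+ (e :+ ((d₁ :+ d₀) :+ u₁)))) :+ r₁)) :+ ((d₀ :+ p) :+ r₀))
                 refl (edge X (suc k)) d₁ d₀ (psum s k) r₁ r₀ (psum u k) (u (suc k)) ⟩
    (edge X (suc k) xor ((d₁ xor (psum s k xor (edge X (suc k) xor ((d₁ xor d₀) xor u (suc k))))) xor r₁))
      xor ((d₀ xor psum s k) xor r₀)
      ≡⟨ cong (λ z → (edge X (suc k) xor ((d₁ xor (psum s k xor z)) xor r₁)) xor ((d₀ xor psum s k) xor r₀))
              (sym (s-from-X k)) ⟩
    (edge X (suc k) xor X (suc k)) xor X k ∎
    where
    d₁ d₀ r₁ r₀ : Bool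
    d₁ = edge s (suc k)
    d₀ = edge s k
    r₁ = edge u (suc k)
    r₀ = edge u k

-- The combinatorial core

-- Then X vanishes on
-- 1..m+1 iff X (t+1) = c₀ + Y (t+1) = c₀ + Y (t+2) for all t < m.  Below,
-- the first condition is the evenness of G(S) and the second one is the
-- rotation invariance of θ(G(S)).
module Core (m : ℕ) (X Y : Seq) (c₀ : Bool)
  (X-first : X 1 ≡ false) (X-last : X (suc m) ≡ c₀) (Y-first : Y 1 ≡ false)
  (Y-step : ∀ k → Y (suc k) xor Y k ≡ (edge X (suc k) xor X (suc k)) xor X k) where

  XVanishes : Set
  XVanishes = ∀ k → 1 ≤ k → k ≤ suc m → X k ≡ false

  Balanced : Set
  Balanced = ∀ t → t < m → X (suc t) ≡ c₀ xor Y (suc t) × X (suc t) ≡ c₀ xor Y (suc (suc t))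

  Y-vanishes : (∀ t → t < m → Y (suc (suc t)) ≡ Y (suc t)) → ∀ k → k ≤ m → Y (suc k) ≡ false
  Y-vanishes const zero    _   = Y-first
  Y-vanishes const (suc k) k<m = trans (const k k<m) (Y-vanishes const k (<⇒≤ k<m))

  vanishes⇒balanced : XVanishes → Balanced
  vanishes⇒balanced vanish t t<m =
    trans (vanish (suc t) (s≤s z≤n) (m≤n⇒m≤1+n t<m)) (sym (cong₂ _xor_ c₀≡0 (Y≡0 t (<⇒≤ t<m)))) ,
    trans (vanish (suc t) (s≤s z≤n) (m≤n⇒m≤1+n t<m)) (sym (cong₂ _xor_ c₀≡0 (Y≡0 (suc t) t<m)))
    where
    c₀≡0 : c₀ ≡ false
    c₀≡0 = trans (sym X-last) (vanish (suc m) (s≤s z≤n) ≤-refl)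
    -- Y-step with vanishing X (and hence vanishing edge X) makes Y constant.
    Y-const : ∀ t → t < m → Y (suc (suc t)) ≡ Y (suc t)
    Y-const t t<m = xor≡false⇒≡ (begin
      Y (suc (suc t)) xor Y (suc t)                               ≡⟨ Y-step (suc t) ⟩
      (edge X (suc (suc t)) xor X (suc (suc t))) xor X (suc t)    ≡⟨ cong₂ (λ e x → (e xor x) xor X (suc t))
                                                                       edge-X≡0 (vanish (suc (suc t)) (s≤s z≤n) (s≤s t<m)) ⟩
      X (suc t)                                                   ≡⟨ vanish (suc t) (s≤s z≤n) (m≤n⇒m≤1+n t<m) ⟩
      false                                                       ∎)
      where
      edge-X≡0 : edge X (suc (suc t)) ≡ false
      edge-X≡0 = trans (delta-local≤ X (λ _ → false) (suc m) (suc t) 0 vanish (s≤s t<m)) (delta-false (suc t) 0)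
    Y≡0 : ∀ k → k ≤ m → Y (suc k) ≡ false
    Y≡0 = Y-vanishes Y-const

  balanced⇒vanishes : Balanced → XVanishes
  balanced⇒vanishes bal (suc k) _ (s≤s k≤m) = trans (X≡c₀ k k≤m) c₀≡0
    where
    -- The two balance equations for t make Y (t+1) = Y (t+2).
    Y≡0 : ∀ k → k ≤ m → Y (suc k) ≡ false
    Y≡0 = Y-vanishes λ t t<m → xor≡false⇒≡ (begin
      Y (suc (suc t)) xor Y (suc t)
        ≡⟨ solve 3 (λ c y₂ y₁ → y₂ :+ y₁ := (c :+ y₁) :+ (c :+ y₂)) refl c₀ (Y (suc (suc t))) (Y (suc t)) ⟩
      (c₀ xor Y (suc t)) xor (c₀ xor Y (suc (suc t)))
        ≡⟨ ≡⇒xor≡false (trans (sym (proj₁ (bal t t<m))) (proj₂ (bal t t<m))) ⟩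
      false ∎)
    X≡c₀ : ∀ k → k ≤ m → X (suc k) ≡ c₀
    X≡c₀ k k≤m with m≤n⇒m<n∨m≡n k≤m
    ... | inj₁ k<m  = trans (proj₁ (bal k k<m)) (trans (cong (c₀ xor_) (Y≡0 k k≤m)) (xor-identityʳ c₀))
    ... | inj₂ refl = X-last
    c₀≡0 : c₀ ≡ false
    c₀≡0 = trans (sym (X≡c₀ 0 z≤n)) X-first

<ᵇ-true : ∀ {a b} → a < b → (a <ᵇ b) ≡ true
<ᵇ-true {zero}  {suc b} _         = refl
<ᵇ-true {suc a} {suc b} (s≤s a<b) = <ᵇ-true a<b

<ᵇ-false : ∀ {a b} → b ≤ a → (a <ᵇ b) ≡ false
<ᵇ-false {a}     {zero}  _         = refl
<ᵇ-false {suc a} {suc b} (s≤s b≤a) = <ᵇ-false b≤a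

module _ {k} (S : Vec Bool k) where

  row₁ : Seq
  row₁ j = at S (j ∸ 1)

  adj-above : ∀ {i j} → i < j → adj S i j ≡ stein row₁ i j
  adj-above i<j rewrite <ᵇ-true i<j = refl

  adj-below : ∀ {i j} → j < i → adj S i j ≡ stein row₁ j i
  adj-below {i} {j} j<i rewrite <ᵇ-false (<⇒≤ j<i) | <ᵇ-true j<i = refl

  adj-diagonal : ∀ i → adj S i i ≡ false
  adj-diagonal i rewrite <ᵇ-false (≤-refl {i}) = refl

-- Even Steinhaus graphs and the triangles θ(G(S)) in terms of X and Y

module Correspondence (m : ℕ) (S : Vec Bool m) where

  s : Seq
  s = at S

  -- S reversed and padded in front: s̃ 1 = s_{m+1} = 0, s̃ (k+2) = s_{m-k}.
  s̃ : Seq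
  s̃ k = s (suc (suc m) ∸ k)

  open EdgeIdentity s s̃ using (X; Y; Y-step)

  b : Seq
  b = irF m s

  s-beyond : s (suc m) ≡ false
  s-beyond = at-beyond S m ≤-refl

  X-first : X 1 ≡ false
  X-first = trans (cong (_xor s̃ 1) (xor-same (s 1))) s-beyond

  -- The last entry of the left edge of ∇s̃ is the last entry of the left edge of ∇s.
  X-last : X (suc m) ≡ psum s m
  X-last = begin
    (edge s (suc m) xor (psum s m xor s (suc m))) xor edge s̃ (suc m)
      ≡⟨ cong₂ (λ d z → (d xor (psum s m xor z)) xor edge s̃ (suc m)) edges-agree s-beyond ⟩
    (edge s̃ (suc m) xor (psum s m xor false)) xor edge s̃ (suc m)
      ≡⟨ solve 2 (λ r p → (r :+ (p :+ con false)) :+ r := p) refl (edge s̃ (suc m)) (psum s m) ⟩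
    psum s m ∎
    where
    edges-agree : edge s (suc m) ≡ edge s̃ (suc m)
    edges-agree = delta-mirror s s̃ m 0 0 (λ t t≤m →
      cong s (sym (trans (+-∸-assoc 1 (m∸n≤m m t)) (cong suc (m∸[m∸n]≡n t≤m)))))

  Y-first : Y 1 ≡ false
  Y-first = xor-same (s̃ 1)

  deg : ℕ → Bool
  deg i = psum (adj S i) (suc m)

  deg-first : deg 1 ≡ psum s m
  deg-first = trans (psum-split (adj S 1) 1 m) (psum-local _ s m (λ { (suc j) _ _ → refl }))

  -- Column part of the degree of v_{k+2}: Σ_{j ≤ k+1} a_{j,k+2} telescopes.
  column-sum : ∀ k → psum (adj S (suc (suc k))) (suc k) ≡ edge s (suc (suc k)) xor s (suc (suc k))
  column-sum k = begin
    psum (adj S (suc (suc k))) (suc k)          ≡⟨ psum-local _ _ (suc k) column ⟩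
    psum (λ j → F (suc j) xor F j) (suc k)      ≡⟨ telescope F (suc k) ⟩
    F (suc (suc k)) xor F 1                     ≡⟨ cong (_xor F 1) (trans (stein-delta (row₁ S) (suc k) 1) (delta-shift (row₁ S) (suc k) 0)) ⟩
    edge s (suc (suc k)) xor s (suc (suc k))    ∎
    where
    F : Seq
    F j = stein (row₁ S) j (suc (suc (suc k)))
    column : ∀ j → 1 ≤ j → j ≤ suc k → adj S (suc (suc k)) j ≡ F (suc j) xor F j
    column (suc j) _ j≤k = trans (adj-below S (s≤s j≤k))
      (solve 2 (λ a f → a := (a :+ f) :+ f) refl (stein (row₁ S) (suc j) (suc (suc k))) (F (suc j)))

  -- The last entry a_{k+1,m+1} of row k+1 is, read backwards, an entry of ∇s̃.
  row-end : ∀ k q → suc (k + q) ≡ m →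
    stein (row₁ S) (suc k) (suc (q + suc k)) ≡ edge s̃ (suc (suc k)) xor edge s̃ (suc k)
  row-end k q k+q+1≡m = begin
    stein (row₁ S) (suc k) (suc (q + suc k))   ≡⟨ cong (stein (row₁ S) (suc k) ∘ suc) (+-suc q k) ⟩
    stein (row₁ S) (suc k) (suc (suc q + k))   ≡⟨ stein-delta (row₁ S) k (suc q) ⟩
    delta (row₁ S) k (suc q)                   ≡⟨ delta-shift (row₁ S) k q ⟩
    delta s k q                                ≡⟨ delta-mirror s s̃ k q 1 mirror ⟩
    delta s̃ k 1                                ≡⟨ solve 2 (λ a b → b := (a :+ b) :+ a) refl (delta s̃ k 0) (delta s̃ k 1) ⟩
    edge s̃ (suc (suc k)) xor edge s̃ (suc k)    ∎
    where
    mirror : ∀ t → t ≤ k → s (suc (q + t)) ≡ s̃ (suc (1 + (k ∸ t)))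
    mirror t t≤k = cong s (sym (begin
      m ∸ (k ∸ t)                      ≡⟨ cong (_∸ (k ∸ t)) (sym k+q+1≡m) ⟩
      suc (k + q) ∸ (k ∸ t)            ≡⟨ cong (λ z → suc (z + q) ∸ (k ∸ t)) (sym (m∸n+n≡m t≤k)) ⟩
      suc (k ∸ t + t + q) ∸ (k ∸ t)    ≡⟨ cong (_∸ (k ∸ t)) (arith (k ∸ t) t q) ⟩
      (k ∸ t) + suc (q + t) ∸ (k ∸ t)  ≡⟨ m+n∸m≡n (k ∸ t) (suc (q + t)) ⟩
      suc (q + t)                      ∎))
      where
      arith : ∀ w t q → suc (w + t + q) ≡ w + suc (q + t)
      arith = solve-∀

  -- Row part of the degree of v_{k+2}: Σ_{k+2 < j ≤ m+1} a_{k+2,j} telescopes.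
  row-sum : ∀ k q → suc (k + q) ≡ m →
    psum (λ j → adj S (suc (suc k)) (suc (suc k) + j)) q ≡ (edge s̃ (suc (suc k)) xor edge s̃ (suc k)) xor edge s (suc k)
  row-sum k q k+q+1≡m = begin
    psum (λ j → adj S (suc (suc k)) (suc (suc k) + j)) q   ≡⟨ psum-local _ _ q row ⟩
    psum (λ j → B (suc j) xor B j) q                       ≡⟨ telescope B q ⟩
    B (suc q) xor B 1                                      ≡⟨ cong₂ _xor_ (row-end k q k+q+1≡m) (trans (stein-delta (row₁ S) k 1) (delta-shift (row₁ S) k 0)) ⟩
    (edge s̃ (suc (suc k)) xor edge s̃ (suc k)) xor edge s (suc k) ∎
    where
    B : Seq
    B j = stein (row₁ S) (suc k) (j + suc k)
    row : ∀ j → 1 ≤ j → j ≤ q → adj S (suc (suc k)) (suc (suc k) + j) ≡ B (suc j) xor B j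
    row (suc j) _ _ = begin
      adj S (suc (suc k)) (suc (suc (k + suc j)))
        ≡⟨ adj-above S {suc (suc k)} (s≤s (s≤s (≤-trans (s≤s (m≤m+n k j)) (≤-reflexive (sym (+-suc k j)))))) ⟩
      stein (row₁ S) (suc k) (suc (k + suc j)) xor stein (row₁ S) (suc k) (suc (suc (k + suc j)))
        ≡⟨ cong (λ z → stein (row₁ S) (suc k) (suc z) xor stein (row₁ S) (suc k) (suc (suc z))) (arith k j) ⟩
      B (suc j) xor B (suc (suc j))
        ≡⟨ xor-comm (B (suc j)) (B (suc (suc j))) ⟩
      B (suc (suc j)) xor B (suc j) ∎
      where
      arith : ∀ k j → k + suc j ≡ j + suc k
      arith = solve-∀

  deg-next : ∀ k → k < m → deg (suc (suc k)) ≡ X (suc (suc k)) xor X (suc k)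
  deg-next k k<m with m≤n⇒∃[o]m+o≡n k<m
  ... | q , refl = begin
    psum f (suc (suc k) + q)
      ≡⟨ psum-split f (suc (suc k)) q ⟩
    (psum f (suc k) xor f (suc (suc k))) xor psum (λ j → f (suc (suc k) + j)) q
      ≡⟨ cong₂ (λ u v → (psum f (suc k) xor u) xor v) (adj-diagonal S (suc (suc k))) (row-sum k q refl) ⟩
    (psum f (suc k) xor false) xor ((r₂ xor r₁) xor d₁)
      ≡⟨ cong (λ u → (u xor false) xor ((r₂ xor r₁) xor d₁)) (column-sum k) ⟩
    ((d₂ xor s (suc (suc k))) xor false) xor ((r₂ xor r₁) xor d₁)
      ≡⟨ solve 6 (λ d₂ s₂ d₁ p₁ r₂ r₁ →
                   ((d₂ :+ s₂) :+ con false) :+ ((r₂ :+ r₁) :+ d₁)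
                   := ((d₂ :+ (p₁ :+ s₂)) :+ r₂) :+ ((d₁ :+ p₁) :+ r₁))
               refl d₂ (s (suc (suc k))) d₁ (psum s (suc k)) r₂ r₁ ⟩
    X (suc (suc k)) xor X (suc k) ∎
    where
    f : Seq
    f = adj S (suc (suc k))
    d₂ d₁ r₂ r₁ : Bool
    d₂ = edge s (suc (suc k))
    d₁ = edge s (suc k)
    r₂ = edge s̃ (suc (suc k))
    r₁ = edge s̃ (suc k)

  open Core m X Y (psum s m) X-first X-last Y-first Y-step public

  even⇒vanishes : EvenSG (suc m) S → XVanishes
  even⇒vanishes even (suc k) _ (s≤s k≤m) = X≡0 k k≤m
    where
    deg≡0 : ∀ i → 1 ≤ i → i ≤ suc m → deg i ≡ false
    deg≡0 i 1≤i i≤m+1 = countF-even⇒psum (adj S i) (suc m) (even i 1≤i i≤m+1)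
    X≡0 : ∀ k → k ≤ m → X (suc k) ≡ false
    X≡0 zero    _   = X-first
    X≡0 (suc k) k<m = trans (xor≡false⇒≡ (trans (sym (deg-next k k<m)) (deg≡0 (suc (suc k)) (s≤s z≤n) (s≤s k<m))))
                              (X≡0 k (<⇒≤ k<m))

  vanishes⇒even : XVanishes → EvenSG (suc m) S
  vanishes⇒even vanish i 1≤i i≤m+1 = psum⇒countF-even (adj S i) (suc m) (deg≡0 i 1≤i i≤m+1)
    where
    deg≡0 : ∀ i → 1 ≤ i → i ≤ suc m → deg i ≡ false
    deg≡0 (suc zero)    _ _         = trans deg-first (trans (sym X-last) (vanish (suc m) (s≤s z≤n) ≤-refl))
    deg≡0 (suc (suc k)) _ (s≤s k<m) = trans (deg-next k k<m)
      (cong₂ _xor_ (vanish (suc (suc k)) (s≤s z≤n) (s≤s k<m)) (vanish (suc k) (s≤s z≤n) (m≤n⇒m≤1+n k<m)))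

  -- ir(S) at odd positions is S, at even positions S backwards, so the
  -- left edge of ∇(ir S) is read off ∇s and ∇s̃.
  delta-ir-even : ∀ t → delta b (twice t) 0 ≡ edge s (suc t)
  delta-ir-even t = delta-decimate b s 0 (irF-odd m s) t 0

  delta-ir-odd : ∀ t → t < m → delta b (suc (twice t)) 0 ≡ edge s (suc t) xor (edge s̃ (suc (suc t)) xor edge s̃ (suc t))
  delta-ir-odd t t<m = cong₂ _xor_ (delta-ir-even t) (begin
    delta b (twice t) 1                        ≡⟨ delta-decimate b (λ k → b (twice k)) 1 (λ _ → refl) t 0 ⟩
    delta (λ k → b (twice k)) t 0              ≡⟨ delta-local _ (s̃ ∘ suc) t 0 even-positions ⟩
    delta (s̃ ∘ suc) t 0                        ≡⟨ sym (delta-shift s̃ t 0) ⟩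
    delta s̃ t 1                                ≡⟨ solve 2 (λ a b → b := (a :+ b) :+ a) refl (delta s̃ t 0) (delta s̃ t 1) ⟩
    edge s̃ (suc (suc t)) xor edge s̃ (suc t)    ∎)
    where
    even-positions : ∀ τ → τ ≤ t → b (twice (suc τ)) ≡ s̃ (suc (suc τ))
    even-positions τ τ≤t = trans (irF-even m s τ) (cong s (sym (+-∸-assoc 1 (≤-<-trans τ≤t t<m))))

  psum-ir-twice : ∀ t → t ≤ m → psum b (twice t) ≡ psum s t xor psum s̃ (suc t)
  psum-ir-twice zero    _   = sym s-beyond
  psum-ir-twice (suc t) t<m = begin
    (psum b (twice t) xor b (suc (twice t))) xor b (twice (suc t))
      ≡⟨ cong₂ (λ u v → (u xor b (suc (twice t))) xor v) (psum-ir-twice t (<⇒≤ t<m)) (irF-even m s t) ⟩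
    ((psum s t xor psum s̃ (suc t)) xor b (suc (twice t))) xor s (suc (m ∸ suc t))
      ≡⟨ cong₂ (λ u v → ((psum s t xor psum s̃ (suc t)) xor u) xor s v) (irF-odd m s t) (sym (+-∸-assoc 1 t<m)) ⟩
    ((psum s t xor psum s̃ (suc t)) xor s (suc t)) xor s (m ∸ t)
      ≡⟨ solve 4 (λ p q a z → ((p :+ q) :+ a) :+ z := (p :+ a) :+ (q :+ z)) refl (psum s t) (psum s̃ (suc t)) (s (suc t)) (s (m ∸ t)) ⟩
    psum s (suc t) xor psum s̃ (suc (suc t)) ∎

  psum-halves : ∀ a q → a + q ≡ m → psum s a xor psum s̃ (suc q) ≡ psum s m
  psum-halves a q refl = begin
    psum s a xor psum s̃ (1 + q)                          ≡⟨ cong (psum s a xor_) (psum-split s̃ 1 q) ⟩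
    psum s a xor (psum s̃ 1 xor psum (s̃ ∘ suc) q)       ≡⟨ cong (λ z → psum s a xor (z xor psum (s̃ ∘ suc) q)) s-beyond ⟩
    psum s a xor psum (λ j → s (suc (a + q) ∸ j)) q      ≡⟨ cong (psum s a xor_) (psum-local _ _ q tail) ⟩
    psum s a xor psum (λ j → s (a + (suc q ∸ j))) q      ≡⟨ cong (psum s a xor_) (psum-reverse (λ j → s (a + j)) q) ⟩
    psum s a xor psum (λ j → s (a + j)) q                ≡⟨ sym (psum-split s a q) ⟩
    psum s (a + q)                                       ∎
    where
    tail : ∀ j → 1 ≤ j → j ≤ q → s (suc (a + q) ∸ j) ≡ s (a + (suc q ∸ j))
    tail j _ j≤q = cong s (trans (cong (_∸ j) (sym (+-suc a q))) (+-∸-assoc a (m≤n⇒m≤1+n j≤q)))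

  c₀≡psum : psum b m ≡ psum s m
  c₀≡psum with parity m
  ... | t , inj₁ refl = trans (psum-ir-twice t (n≤twice t)) (psum-halves t t (sym (twice≡+ t)))
  ... | t , inj₂ refl = begin
    psum b (twice t) xor b (suc (twice t))              ≡⟨ cong₂ _xor_ (psum-ir-twice t (m≤n⇒m≤1+n (n≤twice t))) (irF-odd m s t) ⟩
    (psum s t xor psum s̃ (suc t)) xor s (suc t)         ≡⟨ solve 3 (λ p q a → (p :+ q) :+ a := (p :+ a) :+ q) refl (psum s t) (psum s̃ (suc t)) (s (suc t)) ⟩
    psum s (suc t) xor psum s̃ (suc t)                   ≡⟨ psum-halves (suc t) t (cong suc (sym (twice≡+ t))) ⟩
    psum s (suc (twice t))                              ∎

  defect-even : ∀ t → t < m →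
    delta b (twice t) 0 xor (psum b m xor psum b (suc (twice t))) ≡ X (suc t) xor (psum s m xor Y (suc t))
  defect-even t t<m = begin
    delta b (twice t) 0 xor (psum b m xor (psum b (twice t) xor b (suc (twice t))))
      ≡⟨ cong₂ (λ u v → u xor (v xor (psum b (twice t) xor b (suc (twice t))))) (delta-ir-even t) c₀≡psum ⟩
    edge s (suc t) xor (psum s m xor (psum b (twice t) xor b (suc (twice t))))
      ≡⟨ cong₂ (λ u v → edge s (suc t) xor (psum s m xor (u xor v))) (psum-ir-twice t (<⇒≤ t<m)) (irF-odd m s t) ⟩
    edge s (suc t) xor (psum s m xor ((psum s t xor psum s̃ (suc t)) xor s (suc t)))
      ≡⟨ solve 6 (λ d c p q a r → d :+ (c :+ ((p :+ q) :+ a)) := ((d :+ (p :+ a)) :+ r) :+ (c :+ (r :+ q)))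
               refl (edge s (suc t)) (psum s m) (psum s t) (psum s̃ (suc t)) (s (suc t)) (edge s̃ (suc t)) ⟩
    X (suc t) xor (psum s m xor Y (suc t)) ∎

  defect-odd : ∀ t → t < m →
    delta b (suc (twice t)) 0 xor (psum b m xor psum b (twice (suc t))) ≡ X (suc t) xor (psum s m xor Y (suc (suc t)))
  defect-odd t t<m = begin
    delta b (suc (twice t)) 0 xor (psum b m xor psum b (twice (suc t)))
      ≡⟨ cong₂ (λ u v → u xor (v xor psum b (twice (suc t)))) (delta-ir-odd t t<m) c₀≡psum ⟩
    (edge s (suc t) xor (r₂ xor r₁)) xor (psum s m xor psum b (twice (suc t)))
      ≡⟨ cong (λ u → (edge s (suc t) xor (r₂ xor r₁)) xor (psum s m xor u)) (psum-ir-twice (suc t) t<m) ⟩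
    (edge s (suc t) xor (r₂ xor r₁)) xor (psum s m xor (psum s (suc t) xor psum s̃ (suc (suc t))))
      ≡⟨ solve 6 (λ d r₂ r₁ c p q → (d :+ (r₂ :+ r₁)) :+ (c :+ (p :+ q)) := ((d :+ p) :+ r₁) :+ (c :+ (r₂ :+ q)))
               refl (edge s (suc t)) r₂ r₁ (psum s m) (psum s (suc t)) (psum s̃ (suc (suc t))) ⟩
    X (suc t) xor (psum s m xor Y (suc (suc t))) ∎
    where
    r₂ r₁ : Bool
    r₂ = edge s̃ (suc (suc t))
    r₁ = edge s̃ (suc t)

  condition⇒balanced : EdgeCondition m s → Balanced
  condition⇒balanced cond t t<m =
    xor-transfer (defect-even t t<m) (cond (twice t) (<⇒≤ (twice-< t<m))) ,
    xor-transfer (defect-odd t t<m) (cond (suc (twice t)) (twice-< t<m))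

  balanced⇒condition : Balanced → EdgeCondition m s
  balanced⇒condition bal p p<2m with parity p
  ... | t , inj₁ refl = xor-transfer (sym (defect-even t t<m)) (proj₁ (bal t t<m))
    where
    t<m : t < m
    t<m = twice-<⁻¹ p<2m
  ... | t , inj₂ refl = xor-transfer (sym (defect-odd t t<m)) (proj₂ (bal t t<m))
    where
    t<m : t < m
    t<m = twice-<⁻¹ (<⇒≤ p<2m)

  even⇒condition : EvenSG (suc m) S → EdgeCondition m s
  even⇒condition = balanced⇒condition ∘ vanishes⇒balanced ∘ even⇒vanishes

  condition⇒even : EdgeCondition m s → EvenSG (suc m) S
  condition⇒even = vanishes⇒even ∘ balanced⇒vanishes ∘ condition⇒balanced

module _ (m : ℕ) (S : Vec Bool m) where
  open ThetaRow m S

  condition⇒dst₀ : EdgeCondition m (at S) → DST₀ (2 * suc m ∸ 1) (θ (suc m) S)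
  condition⇒dst₀ cond = firstRow⇒dst₀ _ (θ (suc m) S)
    (subst (λ N → Palindrome N c) (sym (size m)) c-palindrome)
    (subst (λ N → EdgeIsTop N c) (sym (size m)) (condition⇒edge cond))
    (subst (λ N → psum c N ≡ false) (sym (size m)) c-sum)

  dst₀⇒condition : DST₀ (2 * suc m ∸ 1) (θ (suc m) S) → EdgeCondition m (at S)
  dst₀⇒condition dst₀ = edge⇒condition (subst (λ N → EdgeIsTop N c) (size m) (proj₁ (proj₂ (dst₀⇒firstRow _ (θ (suc m) S) dst₀))))

-- Linearity of θ

fromFun-linear : ∀ L (f g h : Seq) → (∀ k → f k ≡ g k xor h k) → fromFun L f ≡ fromFun L g ⊕ fromFun L h
fromFun-linear L f g h eq = trans (fromFun-cong L f _ eq) (fromFun-xor L g h)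

ir-linear : ∀ {m} (S S′ : Vec Bool m) → ir (S ⊕ S′) ≡ ir S ⊕ ir S′
ir-linear {m} S S′ = fromFun-linear (2 * m) _ (irF m (at S)) (irF m (at S′)) irF-⊕
  where
  irF-⊕ : ∀ p → irF m (at (S ⊕ S′)) p ≡ irF m (at S) p xor irF m (at S′) p
  irF-⊕ p with isOdd p
  ... | true  = at-⊕ S S′ (suc ⌊ p /2⌋)
  ... | false = at-⊕ S S′ (suc (m ∸ ⌊ p /2⌋))

antider-linear : ∀ {L} i (A B : Vec Bool L) → antider i false (A ⊕ B) ≡ antider i false A ⊕ antider i false B
antider-linear {L} i A B = fromFun-linear (suc L) _ (integral A) (integral B) λ j → begin
  psum (at (A ⊕ B)) (i ∸ 1) xor psum (at (A ⊕ B)) (j ∸ 1)      ≡⟨ cong₂ _xor_ (psum-⊕ (i ∸ 1)) (psum-⊕ (j ∸ 1)) ⟩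
  (psum (at A) (i ∸ 1) xor psum (at B) (i ∸ 1)) xor (psum (at A) (j ∸ 1) xor psum (at B) (j ∸ 1))
    ≡⟨ solve 4 (λ a b c d → (a :+ b) :+ (c :+ d) := (a :+ c) :+ (b :+ d)) refl
         (psum (at A) (i ∸ 1)) (psum (at B) (i ∸ 1)) (psum (at A) (j ∸ 1)) (psum (at B) (j ∸ 1)) ⟩
  (psum (at A) (i ∸ 1) xor psum (at A) (j ∸ 1)) xor (psum (at B) (i ∸ 1) xor psum (at B) (j ∸ 1)) ∎
  where
  integral : Vec Bool L → Seq
  integral V j = psum (at V) (i ∸ 1) xor psum (at V) (j ∸ 1)
  psum-⊕ : ∀ k → psum (at (A ⊕ B)) k ≡ psum (at A) k xor psum (at B) k
  psum-⊕ k = trans (psum-local _ _ k (λ j _ _ → at-⊕ A B j)) (psum-xor (at A) (at B) k)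

θ-linear : ∀ n (S S′ : Vec Bool (n ∸ 1)) → θ n (S ⊕ S′) ≡ θ n S ⊕ θ n S′
θ-linear n S S′ = fromFun-linear (2 * n ∸ 1) _ (at (antider n false (ir S))) (at (antider n false (ir S′))) λ k → begin
  at (antider n false (ir (S ⊕ S′))) k                        ≡⟨ cong (λ V → at (antider n false V) k) (ir-linear S S′) ⟩
  at (antider n false (ir S ⊕ ir S′)) k                       ≡⟨ cong (λ V → at V k) (antider-linear n (ir S) (ir S′)) ⟩
  at (antider n false (ir S) ⊕ antider n false (ir S′)) k     ≡⟨ at-⊕ (antider n false (ir S)) (antider n false (ir S′)) k ⟩
  at (antider n false (ir S)) k xor at (antider n false (ir S′)) k ∎

-- The inverse of θ

-- s_{k+1} = t_{2k+1} + t_{2k+2}: S is read off the second row of ∇T.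
pair-sums : Seq → Seq
pair-sums t zero    = false
pair-sums t (suc k) = t (suc (twice k)) xor t (suc (suc (twice k)))

θ⁻¹ : ∀ m → Vec Bool (2 * suc m ∸ 1) → Vec Bool m
θ⁻¹ m T = fromFun m (pair-sums (at T))

θ⁻¹-θ : ∀ m (S : Vec Bool m) → θ⁻¹ m (θ (suc m) S) ≡ S
θ⁻¹-θ m S = vec-ext (θ⁻¹ m (θ (suc m) S)) S λ k k<m → begin
  at (θ⁻¹ m (θ (suc m) S)) (suc k)         ≡⟨ at-fromFun m (pair-sums c) k k<m ⟩
  c (suc (twice k)) xor c (suc (suc (twice k)))  ≡⟨ c-differences (twice k) (<⇒≤ (twice-< k<m)) ⟩
  b (suc (twice k))                        ≡⟨ irF-odd m (at S) k ⟩
  at S (suc k)                             ∎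
  where open ThetaRow m S

module Inverse (m : ℕ) (T : Vec Bool (2 * suc m ∸ 1))
  (pal : Palindrome (suc (twice m)) (at T)) (sum : psum (at T) (suc (twice m)) ≡ false) where

  t : Seq
  t = at T

  s : Seq
  s = at (θ⁻¹ m T)

  open ThetaRow m (θ⁻¹ m T) using (b; c-value)

  t-middle : t (suc m) ≡ false
  t-middle = trans (sym (psum-odd-palindrome m t pal)) sum

  b-differences : ∀ p → p < twice m → b (suc p) ≡ t (suc p) xor t (suc (suc p))
  b-differences p p<2m with parity p
  ... | j , inj₁ refl = trans (irF-odd m s j) (at-fromFun m (pair-sums t) j (twice-<⁻¹ p<2m))
  ... | j , inj₂ refl = begin
    b (twice (suc j))                                    ≡⟨ irF-even m s j ⟩
    at (θ⁻¹ m T) (suc w)                                 ≡⟨ at-fromFun m (pair-sums t) w w<m ⟩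
    t (suc (twice w)) xor t (suc (suc (twice w)))        ≡⟨ cong₂ _xor_ (pal (twice w) (suc (suc (twice j))) (cong suc mirror₁))
                                                                        (pal (suc (twice w)) (suc (twice j)) (cong suc mirror₂)) ⟩
    t (suc (suc (suc (twice j)))) xor t (suc (suc (twice j)))  ≡⟨ xor-comm (t (suc (suc (suc (twice j))))) (t (suc (suc (twice j)))) ⟩
    t (suc (suc (twice j))) xor t (suc (suc (suc (twice j))))  ∎
    where
    j<m : j < m
    j<m = twice-<⁻¹ (<⇒≤ p<2m)
    w : ℕ
    w = m ∸ suc j
    w+j+1≡m : w + suc j ≡ m
    w+j+1≡m = m∸n+n≡m j<m
    w<m : w < m
    w<m = subst (w <_) w+j+1≡m (≤-trans (s≤s (m≤m+n w j)) (≤-reflexive (sym (+-suc w j))))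
    mirror₁ : twice w + suc (suc (twice j)) ≡ twice m
    mirror₁ = trans (twice-+ w (suc j)) (cong twice w+j+1≡m)
    mirror₂ : suc (twice w) + suc (twice j) ≡ twice m
    mirror₂ = trans (sym (+-suc (twice w) (suc (twice j)))) mirror₁

  psum-b : ∀ k → k ≤ twice m → psum b k ≡ t 1 xor t (suc k)
  psum-b k k≤2m = begin
    psum b k                            ≡⟨ psum-local _ _ k (λ { (suc p) _ p<k → trans (b-differences p (≤-trans p<k k≤2m)) (xor-comm (t (suc p)) (t (suc (suc p)))) }) ⟩
    psum (λ j → t (suc j) xor t j) k    ≡⟨ telescope t k ⟩
    t (suc k) xor t 1                   ≡⟨ xor-comm (t (suc k)) (t 1) ⟩
    t 1 xor t (suc k)                   ∎

  θ-θ⁻¹ : θ (suc m) (θ⁻¹ m T) ≡ T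
  θ-θ⁻¹ = vec-ext (θ (suc m) (θ⁻¹ m T)) T λ k k<N → begin
    at (θ (suc m) (θ⁻¹ m T)) (suc k)         ≡⟨ c-value k (k≤2m k<N) ⟩
    psum b m xor psum b k                    ≡⟨ cong₂ _xor_ (psum-b m (n≤twice m)) (psum-b k (k≤2m k<N)) ⟩
    (t 1 xor t (suc m)) xor (t 1 xor t (suc k))  ≡⟨ cong (λ z → (t 1 xor z) xor (t 1 xor t (suc k))) t-middle ⟩
    (t 1 xor false) xor (t 1 xor t (suc k))  ≡⟨ solve 2 (λ a x → (a :+ con false) :+ (a :+ x) := x) refl (t 1) (t (suc k)) ⟩
    t (suc k)                                ∎
    where
    k≤2m : ∀ {k} → k < 2 * suc m ∸ 1 → k ≤ twice m
    k≤2m {k} k<N = ≤-pred (subst (k <_) (size m) k<N)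

mainTheorem2 : (n : ℕ) → 1 ≤ n →
    ((S : Vec Bool (n ∸ 1)) → EvenSG n S → DST₀ (2 * n ∸ 1) (θ n S))
    × ((S S′ : Vec Bool (n ∸ 1)) → EvenSG n S → EvenSG n S′ →
         θ n (S ⊕ S′) ≡ θ n S ⊕ θ n S′)
    × ((S S′ : Vec Bool (n ∸ 1)) → EvenSG n S → EvenSG n S′ →
         θ n S ≡ θ n S′ → S ≡ S′)
    × ((T : Vec Bool (2 * n ∸ 1)) → DST₀ (2 * n ∸ 1) T →
         Σ[ S ∈ Vec Bool (n ∸ 1) ] (EvenSG n S × θ n S ≡ T))
mainTheorem2 zero    ()
mainTheorem2 (suc m) _ = into , (λ S S′ _ _ → θ-linear (suc m) S S′) , injective , onto
  where
  into : (S : Vec Bool m) → EvenSG (suc m) S → DST₀ (2 * suc m ∸ 1) (θ (suc m) S)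
  into S = condition⇒dst₀ m S ∘ Correspondence.even⇒condition m S

  injective : (S S′ : Vec Bool m) → EvenSG (suc m) S → EvenSG (suc m) S′ → θ (suc m) S ≡ θ (suc m) S′ → S ≡ S′
  injective S S′ _ _ eq = trans (sym (θ⁻¹-θ m S)) (trans (cong (θ⁻¹ m) eq) (θ⁻¹-θ m S′))

  onto : (T : Vec Bool (2 * suc m ∸ 1)) → DST₀ (2 * suc m ∸ 1) T → Σ[ S ∈ Vec Bool m ] (EvenSG (suc m) S × θ (suc m) S ≡ T)
  onto T dst₀ with dst₀⇒firstRow _ T dst₀
  ... | pal , _ , sum = θ⁻¹ m T , even , θ-θ⁻¹
    where
    open Inverse m T (subst (λ N → Palindrome N (at T)) (size m) pal) (subst (λ N → psum (at T) N ≡ false) (size m) sum)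
    even : EvenSG (suc m) (θ⁻¹ m T)
    even = Correspondence.condition⇒even m (θ⁻¹ m T)
             (dst₀⇒condition m (θ⁻¹ m T) (subst (DST₀ (2 * suc m ∸ 1)) (sym θ-θ⁻¹) dst₀))
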